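{- For relatively prime nonzero integers $a,b$ define $\widetilde{\chi}(a/b)=\lambda(b)\,(1-2\lambda(a))$. Let $n$ be a positive integer and let $\mathcal{V}(Z(n))=B_1\times\cdots\times B_s$. Then \[\chi(n)=\widetilde{\chi}(\langle B_1\rangle)\,\widetilde{\chi}(\langle B_2\rangle)\cdots\widetilde{\chi}(\langle B_s\rangle).\]
   Context: Let $f_0=f_1=1$, $f_i=f_{i-1}+f_{i-2}$ ($i\ge2$). A Fibonacci partition of $n$ is a finite set $\{f_{i_1},\dots,f_{i_h}\}$ with $1\le i_1<\dots<i_h$ and sum $n$; $F_h(n)$ is the number with $h$ parts and $\chi(n)=\sum_{h\ge0}(-1)^hF_h(n)$. For an integer $m$, $\lambda(m)=m\bmod2\in\{0,1\}$. A 2-partition is a finite set $\{i_1<\dots<i_q\}$ of positive integers with consecutive differences $\ge2$; $Z(n)=\{\mu_1(n)<\dots<\mu_q(n)\}$ is the unique 2-partition with $n=\sum_a f_{\mu_a(n)}$ (Zeckendorf). The canonical form of a nonempty 2-partition $I$ is its decomposition $I=I_1\cup\dots\cup I_s$ into maximal runs of consecutive elements of equal parity (so all elements of each $I_a$ have the same parity, $\max I_a<\min I_{a+1}$ and $\min I_{a+1}-\max I_a$ is odd). The associated vector of $I=\{i_1<\dots<i_q\}$ is $(\alpha_1,\dots,\alpha_q)$ with $\alpha_1=\lfloor(i_1-1)/2\rfloor+1$, $\alpha_r=\lfloor(i_r-i_{r-1})/2\rfloor+1$ ($r>1$); splitting it into consecutive blocks $B_1,\dots,B_s$ of lengths $|I_1|,\dots,|I_s|$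 gives the associated multivector $\mathcal{V}(I)=B_1\times\cdots\times B_s$. With $\phi_\alpha(t)=t+\dots+t^\alpha$, let $D(\emptyset;t)=1$, $D(\alpha_1;t)=\phi_{\alpha_1}(t)$, $D(\alpha_1,\dots,\alpha_r;t)=\phi_{\alpha_r}(t)D(\alpha_1,\dots,\alpha_{r-1};t)-t^{\alpha_r+1}D(\alpha_1,\dots,\alpha_{r-2};t)$, and $D(A)=D(A;1)$. For $B=(\beta_1,\dots,\beta_q)$ put $\langle B\rangle=D(\beta_2,\dots,\beta_q)/D(\beta_1,\dots,\beta_q)$, regarded as a fraction in lowest terms (numerator and denominator are coprime positive integers). -}

module Defs where

open import Data.Nat as N using (ℕ; zero; suc; _∸_; _≤_; _<_; _≡ᵇ_)
open import Data.Nat.DivMod using (_/_; _%_)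
open import Data.Integer as ℤ using (ℤ; +_; -[1+_]; ∣_∣)
open import Data.Rational as ℚ using (ℚ; ↥_; ↧_; 0ℚ)
open import Data.List using (List; []; _∷_; [_]; length; map; foldr; filter; take; drop; reverse; upTo)
open import Data.Bool using (Bool; if_then_else_)
open import Relation.Binary.PropositionalEquality using (_≡_)

fib : ℕ → ℕ
fib zero = 1
fib (suc zero) = 1
fib (suc (suc i)) = fib (suc i) + fib i
  where open N using (_+_)

sumℕ : List ℕ → ℕ
sumℕ = foldr N._+_ 0

sublists : List ℕ → List (List ℕ)
sublists [] = [] ∷ []
sublists (x ∷ xs) = let r = sublists xs in map (x ∷_) r Data.List.++ r
  where import Data.List

indices1to : ℕ → List ℕ
indices1to n = map suc (upTo n)

-- Fibonacci partitions of n: sets {f_{i_1},...,f_{i_h}}, 1 ≤ i_1 < ... < i_h, with sum n,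
-- represented by their index sets (strictly increasing lists).  Since f_i ≥ i for i ≥ 1,
-- every index occurring in a partition of n is ≤ n.
fibPartitions : ℕ → List (List ℕ)
fibPartitions n = filter (λ S → sumℕ (map fib S) N.≟ n) (sublists (indices1to n))

F : ℕ → ℕ → ℕ
F h n = length (filter (λ S → length S N.≟ h) (fibPartitions n))

sgn : ℕ → ℤ
sgn zero = + 1
sgn (suc h) = ℤ.- sgn h

-- χ(n) = Σ_{h ≥ 0} (-1)^h F_h(n)  (F_h(n) = 0 for h > n since every part is ≥ 1)
χ : ℕ → ℤ
χ n = foldr ℤ._+_ (+ 0) (map (λ h → sgn h ℤ.* (+ F h n)) (upTo (suc n)))

lam : ℤ → ℤ
lam m = + (∣ m ∣ % 2)

data Gaps≥2 : List ℕ → Set where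
  g-nil  : Gaps≥2 []
  g-one  : ∀ {i} → Gaps≥2 (i ∷ [])
  g-cons : ∀ {i j is} → 2 N.+ i ≤ j → Gaps≥2 (j ∷ is) → Gaps≥2 (i ∷ j ∷ is)

data AllPos : List ℕ → Set where
  p-nil  : AllPos []
  p-cons : ∀ {i is} → 1 ≤ i → AllPos is → AllPos (i ∷ is)

record IsTwoPartition (I : List ℕ) : Set where
  field
    positive : AllPos I
    gaps     : Gaps≥2 I

IsZeckendorf : ℕ → List ℕ → Set
IsZeckendorf n I = IsTwoPartition I Data.Product.× (sumℕ (map fib I) ≡ n)
  where import Data.Product

-- canonical form: maximal runs of consecutive elements of equal parity
parity : ℕ → ℕ
parity i = i % 2

runs : List ℕ → List (List ℕ)
runs [] = []
runs (x ∷ xs) = attach x (runs xs)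
  where
  attach : ℕ → List (List ℕ) → List (List ℕ)
  attach x ((y ∷ r) ∷ rs) = if parity x ≡ᵇ parity y then (x ∷ y ∷ r) ∷ rs else [ x ] ∷ (y ∷ r) ∷ rs
  attach x rs = [ x ] ∷ rs

assocFrom : ℕ → List ℕ → List ℕ
assocFrom prev [] = []
assocFrom prev (i ∷ is) = suc ((i ∸ prev) / 2) ∷ assocFrom i is

assocVec : List ℕ → List ℕ
assocVec = assocFrom 1

splitBy : List ℕ → List ℕ → List (List ℕ)
splitBy [] xs = []
splitBy (k ∷ ks) xs = take k xs ∷ splitBy ks (drop k xs)

-- associated multivector V(I) = B_1 × ... × B_s (as the list of blocks)
multivector : List ℕ → List (List ℕ)
multivector I = splitBy (map length (runs I)) (assocVec I)

φ : ℕ → ℤ → ℤ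
φ zero t = + 0
φ (suc a) t = φ a t ℤ.+ t ℤ.^ suc a

-- D on the reversed list: Drev (α_r ∷ α_{r-1} ∷ ...) = D(α_1,...,α_r)
Drev : List ℕ → ℤ → ℤ
Drev [] t = + 1
Drev (a ∷ []) t = φ a t
Drev (a ∷ b ∷ rest) t = φ a t ℤ.* Drev (b ∷ rest) t ℤ.- t ℤ.^ suc a ℤ.* Drev rest t

Dpoly : List ℕ → ℤ → ℤ
Dpoly A t = Drev (reverse A) t

D : List ℕ → ℤ
D A = Dpoly A (+ 1)

tail' : List ℕ → List ℕ
tail' [] = []
tail' (_ ∷ xs) = xs

-- the fraction a/b in lowest terms (positive denominator); b = 0 never occurs here
frac : ℤ → ℤ → ℚ
frac a (+ zero) = 0ℚ
frac a (+ suc k) = a ℚ./ suc k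
frac a -[1+ k ] = (ℤ.- a) ℚ./ suc k

bracket : List ℕ → ℚ
bracket B = frac (D (tail' B)) (D B)

χ̃ : ℚ → ℤ
χ̃ q = lam (↧ q) ℤ.* (+ 1 ℤ.- + 2 ℤ.* lam (↥ q))

productℤ : List ℤ → ℤ
productℤ = foldr ℤ._*_ (+ 1)

-- χ(n) is the coefficient of q^n in ∏_{i ≤ n} (1 - q^{f_i}).  Walking along the
-- Zeckendorf indices i₁ < ⋯ < i_q of n, the coefficients that matter at each
-- prefix sum form a state (X , Y) ∈ ℤ², and passing to the next index applies
-- a map that depends only on the gap d = i_r - i_{r-1} and is 4-periodic in d.
-- An odd gap, which is exactly where a new parity run of Z(n) begins, resets the
-- state to a multiple of X; so χ(n) is the product of the values of the runs.
-- An even gap acts by one of two linear maps, chosen by the parity of the entry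
-- α_r of the associated vector.  Along a run these maps mirror the continuant
-- recursion D(…, α_r) = α_r D(…) - D(…) modulo 2: the state is a function of the
-- parities of two consecutive continuant pairs, which are unimodular (hence
-- coprime), and its first component is χ̃⟨B⟩.

module Submission where

open import Defs
open import Data.Nat using (ℕ; _<_)
open import Data.List using (List; map)
open import Relation.Binary.PropositionalEquality using (_≡_)

open import Data.Bool using (true; false; if_then_else_)
open import Data.Integer as ℤ using (ℤ; +_; -[1+_]; _+_; _-_; _*_; -_)
import Data.Integer.Properties as ℤₚ
open import Data.Integer.Tactic.RingSolver using (solve-∀)
open import Data.List as List
  using ([]; _∷_; [_]; _++_; _∷ʳ_; length; foldr; filter; applyUpTo; reverse; take; drop)
import Data.List.Properties as Listₚ
open import Data.List.Relation.Unary.All as All using (All; []; _∷_)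
import Data.List.Relation.Unary.All.Properties as Allₚ
open import Data.Nat as ℕ using (zero; suc; _∸_; _≤_; z≤n; s≤s)
open import Data.Nat.Base using () renaming (parity to parityℙ)
open import Data.Nat.Coprimality using (Coprime)
open import Data.Nat.Divisibility using (_∣_; ∣1⇒≡1; ∣m+n∣m⇒∣n; ∣m⇒∣m*n)
open import Data.Nat.DivMod as DivMod using (_/_; _%_)
import Data.Nat.Properties as ℕₚ
import Data.Nat.Tactic.RingSolver as ℕ-Solver
open import Data.Parity.Base as ℙ using (Parity; 0ℙ; 1ℙ)
import Data.Parity.Properties as ℙₚ
open import Data.Product using (∃; ∃₂; _×_; _,_; proj₁; proj₂)
import Data.Rational.Properties as ℚₚ
open import Data.Sum using (_⊎_; inj₁; inj₂)
open import Function using (_∘_; id)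
open import Relation.Binary.PropositionalEquality
  using (refl; sym; trans; cong; cong₂; subst; module ≡-Reasoning)
open import Relation.Nullary using (does; yes; no; contradiction)

-- Alternating sums over Fibonacci partitions

sumℤ : List ℤ → ℤ
sumℤ = foldr _+_ (+ 0)

sumℤ-++ : ∀ xs ys → sumℤ (xs ++ ys) ≡ sumℤ xs + sumℤ ys
sumℤ-++ [] ys = sym (ℤₚ.+-identityˡ _)
sumℤ-++ (x ∷ xs) ys = trans (cong (λ r → x + r) (sumℤ-++ xs ys)) (sym (ℤₚ.+-assoc x _ _))

sumUpTo : ℕ → (ℕ → ℤ) → ℤ
sumUpTo zero f = + 0
sumUpTo (suc N) f = f 0 + sumUpTo N (f ∘ suc)

sumℤ-map-applyUpTo : ∀ (f : ℕ → ℤ) g N → sumℤ (map f (applyUpTo g N)) ≡ sumUpTo N (f ∘ g)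
sumℤ-map-applyUpTo f g zero = refl
sumℤ-map-applyUpTo f g (suc N) = cong (λ r → f (g 0) + r) (sumℤ-map-applyUpTo f (g ∘ suc) N)

sumUpTo-cong : ∀ N {f g : ℕ → ℤ} → (∀ h → f h ≡ g h) → sumUpTo N f ≡ sumUpTo N g
sumUpTo-cong zero eq = refl
sumUpTo-cong (suc N) eq = cong₂ _+_ (eq 0) (sumUpTo-cong N (eq ∘ suc))

sumUpTo-zero : ∀ N → sumUpTo N (λ _ → + 0) ≡ + 0
sumUpTo-zero zero = refl
sumUpTo-zero (suc N) = trans (ℤₚ.+-identityˡ _) (sumUpTo-zero N)

sumUpTo-+ : ∀ N (f g : ℕ → ℤ) → sumUpTo N (λ h → f h + g h) ≡ sumUpTo N f + sumUpTo N g
sumUpTo-+ zero f g = refl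
sumUpTo-+ (suc N) f g = trans (cong (λ r → (f 0 + g 0) + r) (sumUpTo-+ N (f ∘ suc) (g ∘ suc)))
  (interchange (f 0) (g 0) (sumUpTo N (f ∘ suc)) (sumUpTo N (g ∘ suc)))
  where
  interchange : ∀ a b c d → (a + b) + (c + d) ≡ (a + c) + (b + d)
  interchange = solve-∀

δ : ℕ → ℕ → ℤ
δ a b = if a ℕ.≡ᵇ b then + 1 else + 0

sumUpTo-δ : ∀ N (f : ℕ → ℤ) s → s < N → sumUpTo N (λ h → f h * δ s h) ≡ f s
sumUpTo-δ (suc N) f zero _ = begin
    f 0 * + 1 + sumUpTo N (λ h → f (suc h) * + 0)
  ≡⟨ cong₂ _+_ (ℤₚ.*-identityʳ (f 0)) (trans (sumUpTo-cong N (ℤₚ.*-zeroʳ ∘ f ∘ suc)) (sumUpTo-zero N)) ⟩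
    f 0 + + 0
  ≡⟨ ℤₚ.+-identityʳ (f 0) ⟩
    f 0 ∎
  where open ≡-Reasoning
sumUpTo-δ (suc N) f (suc s) (s≤s s<N) = begin
    f 0 * + 0 + sumUpTo N (λ h → f (suc h) * δ s h)
  ≡⟨ cong (_+ sumUpTo N (λ h → f (suc h) * δ s h)) (ℤₚ.*-zeroʳ (f 0)) ⟩
    + 0 + sumUpTo N (λ h → f (suc h) * δ s h)
  ≡⟨ ℤₚ.+-identityˡ _ ⟩
    sumUpTo N (λ h → f (suc h) * δ s h)
  ≡⟨ sumUpTo-δ N (f ∘ suc) s s<N ⟩
    f (suc s) ∎
  where open ≡-Reasoning

count : ℕ → List (List ℕ) → ℕ
count h P = length (filter (λ S → length S ℕ.≟ h) P)

count-∷ : ∀ h S P → + count h (S ∷ P) ≡ δ (length S) h + + count h P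
count-∷ h S P with length S ℕ.≡ᵇ h
... | true = refl
... | false = refl

sumUpTo-alternating-count : ∀ N P → All (λ S → length S < N) P →
  sumUpTo N (λ h → sgn h * + count h P) ≡ sumℤ (map (sgn ∘ length) P)
sumUpTo-alternating-count N [] [] = trans (sumUpTo-cong N (ℤₚ.*-zeroʳ ∘ sgn)) (sumUpTo-zero N)
sumUpTo-alternating-count N (S ∷ P) (|S|<N ∷ |P|<N) = begin
    sumUpTo N (λ h → sgn h * + count h (S ∷ P))
  ≡⟨ sumUpTo-cong N (λ h → trans (cong (sgn h *_) (count-∷ h S P)) (ℤₚ.*-distribˡ-+ (sgn h) _ _)) ⟩
    sumUpTo N (λ h → sgn h * δ (length S) h + sgn h * + count h P)
  ≡⟨ sumUpTo-+ N _ _ ⟩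
    sumUpTo N (λ h → sgn h * δ (length S) h) + sumUpTo N (λ h → sgn h * + count h P)
  ≡⟨ cong₂ _+_ (sumUpTo-δ N sgn (length S) |S|<N) (sumUpTo-alternating-count N P |P|<N) ⟩
    sgn (length S) + sumℤ (map (sgn ∘ length) P) ∎
  where open ≡-Reasoning

fibSum : List ℕ → ℕ
fibSum S = sumℕ (map fib S)

signedWeight : ℤ → List ℕ → ℤ
signedWeight m S = if does (+ fibSum S ℤ.≟ m) then sgn (length S) else + 0

-- signedCount L m is the coefficient of q^m in the polynomial ∏_{i ∈ L} (1 - q^{f_i}).
signedCount : List ℕ → ℤ → ℤ
signedCount [] m = if does (+ 0 ℤ.≟ m) then + 1 else + 0
signedCount (i ∷ L) m = signedCount L m - signedCount L (m - + fib i)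

signedWeight-∷ : ∀ m i S → signedWeight m (i ∷ S) ≡ - signedWeight (m - + fib i) S
signedWeight-∷ m i S with + (fib i ℕ.+ fibSum S) ℤ.≟ m | + fibSum S ℤ.≟ m - + fib i
... | yes _ | yes _ = refl
... | no _  | no _  = refl
... | yes p | no ¬q = contradiction (trans (sym (a+b-a≡b (+ fib i) _)) (cong (_- + fib i) p)) ¬q
  where a+b-a≡b : ∀ a b → (a + b) - a ≡ b
        a+b-a≡b = solve-∀
... | no ¬p | yes q = contradiction (trans (cong (_+_ (+ fib i)) q) (a+[m-a]≡m (+ fib i) m)) ¬p
  where a+[m-a]≡m : ∀ a m → a + (m - a) ≡ m
        a+[m-a]≡m = solve-∀

sum-signedWeight-map-∷ : ∀ m i Ss →
  sumℤ (map (signedWeight m) (map (i ∷_) Ss)) ≡ - sumℤ (map (signedWeight (m - + fib i)) Ss)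
sum-signedWeight-map-∷ m i [] = refl
sum-signedWeight-map-∷ m i (S ∷ Ss) = begin
    signedWeight m (i ∷ S) + sumℤ (map (signedWeight m) (map (i ∷_) Ss))
  ≡⟨ cong₂ _+_ (signedWeight-∷ m i S) (sum-signedWeight-map-∷ m i Ss) ⟩
    - signedWeight m′ S + - sumℤ (map (signedWeight m′) Ss)
  ≡⟨ ℤₚ.neg-distrib-+ (signedWeight m′ S) _ ⟨
    - sumℤ (map (signedWeight m′) (S ∷ Ss)) ∎
  where open ≡-Reasoning
        m′ = m - + fib i

sum-signedWeight-sublists : ∀ L m → sumℤ (map (signedWeight m) (sublists L)) ≡ signedCount L m
sum-signedWeight-sublists [] m = ℤₚ.+-identityʳ _
sum-signedWeight-sublists (i ∷ L) m = begin
    sumℤ (map (signedWeight m) (map (i ∷_) Ss ++ Ss))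
  ≡⟨ cong sumℤ (Listₚ.map-++ (signedWeight m) (map (i ∷_) Ss) Ss) ⟩
    sumℤ (map (signedWeight m) (map (i ∷_) Ss) ++ map (signedWeight m) Ss)
  ≡⟨ sumℤ-++ (map (signedWeight m) (map (i ∷_) Ss)) _ ⟩
    sumℤ (map (signedWeight m) (map (i ∷_) Ss)) + sumℤ (map (signedWeight m) Ss)
  ≡⟨ cong₂ _+_ (sum-signedWeight-map-∷ m i Ss) (sum-signedWeight-sublists L m) ⟩
    - sumℤ (map (signedWeight (m - + fib i)) Ss) + signedCount L m
  ≡⟨ cong (λ r → - r + signedCount L m) (sum-signedWeight-sublists L (m - + fib i)) ⟩
    - signedCount L (m - + fib i) + signedCount L m
  ≡⟨ ℤₚ.+-comm _ (signedCount L m) ⟩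
    signedCount (i ∷ L) m ∎
  where open ≡-Reasoning
        Ss = sublists L

sum-sgn-fibPartitions : ∀ n Ss → sumℤ (map (sgn ∘ length) (filter (λ S → fibSum S ℕ.≟ n) Ss))
                                 ≡ sumℤ (map (signedWeight (+ n)) Ss)
sum-sgn-fibPartitions n [] = refl
sum-sgn-fibPartitions n (S ∷ Ss) with fibSum S ℕ.≡ᵇ n
... | true = cong (_+_ (sgn (length S))) (sum-sgn-fibPartitions n Ss)
... | false = trans (sum-sgn-fibPartitions n Ss) (sym (ℤₚ.+-identityˡ _))

length-sublists : ∀ L → All (λ S → length S ≤ length L) (sublists L)
length-sublists [] = z≤n ∷ []
length-sublists (i ∷ L) =
  Allₚ.++⁺ (Allₚ.map⁺ (All.map s≤s (length-sublists L))) (All.map ℕₚ.m≤n⇒m≤1+n (length-sublists L))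

length-fibPartitions : ∀ n → All (λ S → length S < suc n) (fibPartitions n)
length-fibPartitions n = Allₚ.filter⁺ (λ S → fibSum S ℕ.≟ n)
  (All.map (λ le → s≤s (subst (_ ≤_) |indices|≡n le)) (length-sublists (indices1to n)))
  where |indices|≡n = trans (Listₚ.length-map suc (List.upTo n)) (Listₚ.length-applyUpTo id n)

χ≡signedCount : ∀ n → χ n ≡ signedCount (indices1to n) (+ n)
χ≡signedCount n = begin
    χ n
  ≡⟨ sumℤ-map-applyUpTo (λ h → sgn h * + F h n) id (suc n) ⟩
    sumUpTo (suc n) (λ h → sgn h * + count h (fibPartitions n))
  ≡⟨ sumUpTo-alternating-count (suc n) (fibPartitions n) (length-fibPartitions n) ⟩
    sumℤ (map (sgn ∘ length) (fibPartitions n))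
  ≡⟨ sum-sgn-fibPartitions n (sublists (indices1to n)) ⟩
    sumℤ (map (signedWeight (+ n)) (sublists (indices1to n)))
  ≡⟨ sum-signedWeight-sublists (indices1to n) (+ n) ⟩
    signedCount (indices1to n) (+ n) ∎
  where open ≡-Reasoning

-- Coefficients of ∏ (1 - q^{f_i})

signedCount-∷ʳ : ∀ L i m → signedCount (L ∷ʳ i) m ≡ signedCount L m - signedCount L (m - + fib i)
signedCount-∷ʳ [] i m = refl
signedCount-∷ʳ (j ∷ L) i m = begin
    signedCount (L ∷ʳ i) m - signedCount (L ∷ʳ i) (m - fⱼ)
  ≡⟨ cong₂ _-_ (signedCount-∷ʳ L i m) (signedCount-∷ʳ L i (m - fⱼ)) ⟩
    (c m - c (m - fᵢ)) - (c (m - fⱼ) - c ((m - fⱼ) - fᵢ))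
  ≡⟨ cong (λ k → (c m - c (m - fᵢ)) - (c (m - fⱼ) - c k)) (swap-minus m fⱼ fᵢ) ⟩
    (c m - c (m - fᵢ)) - (c (m - fⱼ) - c ((m - fᵢ) - fⱼ))
  ≡⟨ regroup (c m) (c (m - fᵢ)) (c (m - fⱼ)) (c ((m - fᵢ) - fⱼ)) ⟩
    (c m - c (m - fⱼ)) - (c (m - fᵢ) - c ((m - fᵢ) - fⱼ)) ∎
  where
  open ≡-Reasoning
  c = signedCount L
  fᵢ = + fib i
  fⱼ = + fib j
  swap-minus : ∀ m a b → (m - a) - b ≡ (m - b) - a
  swap-minus = solve-∀
  regroup : ∀ a b c d → (a - b) - (c - d) ≡ (a - c) - (b - d)
  regroup = solve-∀

signedCount-negative : ∀ L k → signedCount L -[1+ k ] ≡ + 0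
signedCount-negative [] k = refl
signedCount-negative (i ∷ L) k
  rewrite ℤₚ.neg-minus-pos k (fib i) | signedCount-negative L k | signedCount-negative L (fib i ℕ.+ k) = refl

signedCount-below : ∀ L {n m} → n < m → signedCount L (+ n - + m) ≡ + 0
signedCount-below L {n} {suc m} (s≤s n≤m) = begin
    signedCount L (+ n - + suc m)
  ≡⟨ cong (signedCount L) (trans (ℤₚ.[+m]-[+n]≡m⊖n n (suc m)) (ℤₚ.⊖-< (s≤s n≤m))) ⟩
    signedCount L (- + (suc m ∸ n))
  ≡⟨ cong (λ k → signedCount L (- + k)) (ℕₚ.+-∸-assoc 1 n≤m) ⟩
    signedCount L -[1+ m ∸ n ]
  ≡⟨ signedCount-negative L (m ∸ n) ⟩
    + 0 ∎
  where open ≡-Reasoning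

+-minus-+ : ∀ {m n} → n ≤ m → + m - + n ≡ + (m ∸ n)
+-minus-+ {m} {n} n≤m = trans (ℤₚ.[+m]-[+n]≡m⊖n m n) (ℤₚ.⊖-≥ n≤m)

signedCount-above : ∀ L n → fibSum L < n → signedCount L (+ n) ≡ + 0
signedCount-above [] (suc n) _ = refl
signedCount-above (i ∷ L) n fᵢ+Σ<n = begin
    signedCount L (+ n) - signedCount L (+ n - + fib i)
  ≡⟨ cong₂ _-_ (signedCount-above L n Σ<n) (cong (signedCount L) (+-minus-+ fᵢ≤n)) ⟩
    + 0 - signedCount L (+ (n ∸ fib i))
  ≡⟨ cong (_-_ (+ 0)) (signedCount-above L (n ∸ fib i) Σ<n∸fᵢ) ⟩
    + 0 ∎
  where
  open ≡-Reasoning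
  Σ<n : fibSum L < n
  Σ<n = ℕₚ.<-≤-trans (s≤s (ℕₚ.m≤n+m (fibSum L) (fib i))) fᵢ+Σ<n
  fᵢ≤n : fib i ≤ n
  fᵢ≤n = ℕₚ.≤-trans (ℕₚ.m≤m+n (fib i) (fibSum L)) (ℕₚ.<⇒≤ fᵢ+Σ<n)
  Σ<n∸fᵢ : fibSum L < n ∸ fib i
  Σ<n∸fᵢ = ℕₚ.m+n≤o⇒m≤o∸n (suc (fibSum L)) (subst (_≤ n) (cong suc (ℕₚ.+-comm (fib i) (fibSum L))) fᵢ+Σ<n)

0<fib : ∀ i → 0 < fib i
0<fib zero = s≤s z≤n
0<fib (suc zero) = s≤s z≤n
0<fib (suc (suc i)) = ℕₚ.≤-trans (0<fib (suc i)) (ℕₚ.m≤m+n (fib (suc i)) (fib i))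

fib-≤-suc : ∀ i → fib i ≤ fib (suc i)
fib-≤-suc zero = ℕₚ.≤-refl
fib-≤-suc (suc i) = ℕₚ.m≤m+n (fib (suc i)) (fib i)

fib-mono-≤ : ∀ {i j} → i ≤ j → fib i ≤ fib j
fib-mono-≤ = mono′ ∘ ℕₚ.≤⇒≤′
  where
  mono′ : ∀ {i j} → i ℕ.≤′ j → fib i ≤ fib j
  mono′ ℕ.≤′-refl = ℕₚ.≤-refl
  mono′ (ℕ.≤′-step {n = j} i≤′j) = ℕₚ.≤-trans (mono′ i≤′j) (fib-≤-suc j)

n≤fib : ∀ n → n ≤ fib n
n≤fib zero = z≤n
n≤fib (suc zero) = s≤s z≤n
n≤fib (suc (suc n)) =
  subst (_≤ fib (suc (suc n))) (ℕₚ.+-comm (suc n) 1) (ℕₚ.+-mono-≤ (n≤fib (suc n)) (0<fib n))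

fibSum-∷ʳ : ∀ L i → fibSum (L ∷ʳ i) ≡ fibSum L ℕ.+ fib i
fibSum-∷ʳ [] i = ℕₚ.+-identityʳ (fib i)
fibSum-∷ʳ (j ∷ L) i = trans (cong (fib j ℕ.+_) (fibSum-∷ʳ L i)) (sym (ℕₚ.+-assoc (fib j) (fibSum L) (fib i)))

indices1to-suc : ∀ n → indices1to (suc n) ≡ indices1to n ∷ʳ suc n
indices1to-suc n = begin
    map suc (List.upTo (suc n))
  ≡⟨ cong (map suc) (Listₚ.upTo-∷ʳ n) ⟨
    map suc (List.upTo n ∷ʳ n)
  ≡⟨ Listₚ.map-++ suc (List.upTo n) [ n ] ⟩
    indices1to n ∷ʳ suc n ∎
  where open ≡-Reasoning

fibSum-indices1to : ∀ k → fibSum (indices1to k) ℕ.+ 2 ≡ fib (suc (suc k))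
fibSum-indices1to zero = refl
fibSum-indices1to (suc k) = begin
    fibSum (indices1to (suc k)) ℕ.+ 2
  ≡⟨ cong (λ L → fibSum L ℕ.+ 2) (indices1to-suc k) ⟩
    fibSum (indices1to k ∷ʳ suc k) ℕ.+ 2
  ≡⟨ cong (ℕ._+ 2) (fibSum-∷ʳ (indices1to k) (suc k)) ⟩
    (fibSum (indices1to k) ℕ.+ fib (suc k)) ℕ.+ 2
  ≡⟨ +-right-comm (fibSum (indices1to k)) (fib (suc k)) 2 ⟩
    (fibSum (indices1to k) ℕ.+ 2) ℕ.+ fib (suc k)
  ≡⟨ cong (ℕ._+ fib (suc k)) (fibSum-indices1to k) ⟩
    fib (suc (suc (suc k))) ∎
  where
  open ≡-Reasoning
  +-right-comm : ∀ a b c → (a ℕ.+ b) ℕ.+ c ≡ (a ℕ.+ c) ℕ.+ b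
  +-right-comm = ℕ-Solver.solve-∀

coeff : ℕ → ℤ → ℤ
coeff k = signedCount (indices1to k)

coeff-suc : ∀ k m → coeff (suc k) m ≡ coeff k m - coeff k (m - + fib (suc k))
coeff-suc k m = trans (cong (λ L → signedCount L m) (indices1to-suc k)) (signedCount-∷ʳ (indices1to k) (suc k) m)

coeff-above : ∀ k n → fib (suc (suc k)) ≤ suc n → coeff k (+ n) ≡ + 0
coeff-above k n f≤1+n = signedCount-above (indices1to k) n (ℕₚ.≤-pred (subst (_≤ suc n) Σ+2≡f f≤1+n))
  where Σ+2≡f = trans (sym (fibSum-indices1to k)) (ℕₚ.+-comm (fibSum (indices1to k)) 2)

coeff-below : ∀ k {n m} → n < m → coeff k (+ n - + m) ≡ + 0
coeff-below k = signedCount-below (indices1to k)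

coeff-zero : ∀ k → coeff k (+ 0) ≡ + 1
coeff-zero zero = refl
coeff-zero (suc k) rewrite coeff-suc k (+ 0) | coeff-zero k | coeff-below k (0<fib (suc k)) = refl

coeff-stable : ∀ e t {n} → n < fib (suc t) → coeff (e ℕ.+ t) (+ n) ≡ coeff t (+ n)
coeff-stable zero t n<f = refl
coeff-stable (suc e) t {n} n<f = begin
    coeff (suc (e ℕ.+ t)) (+ n)
  ≡⟨ coeff-suc (e ℕ.+ t) (+ n) ⟩
    coeff (e ℕ.+ t) (+ n) - coeff (e ℕ.+ t) (+ n - + fib (suc (e ℕ.+ t)))
  ≡⟨ cong (_-_ (coeff (e ℕ.+ t) (+ n))) (coeff-below (e ℕ.+ t) n<f′) ⟩
    coeff (e ℕ.+ t) (+ n) - + 0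
  ≡⟨ ℤₚ.+-identityʳ _ ⟩
    coeff (e ℕ.+ t) (+ n)
  ≡⟨ coeff-stable e t n<f ⟩
    coeff t (+ n) ∎
  where
  open ≡-Reasoning
  n<f′ = ℕₚ.<-≤-trans n<f (fib-mono-≤ (s≤s (ℕₚ.m≤n+m t e)))

-- The transfer recursion along the Zeckendorf indices

-- When the state at a Zeckendorf prefix sum m with top index t is (X , Y),
-- H d X Y is coeff (t + d - 1) at m + f_{t+d} (see coeff-jump).
H : ℕ → ℤ → ℤ → ℤ
H zero X Y = X - Y
H (suc zero) X Y = + 0
H (suc (suc d)) X Y = - H d X Y + X

step : ℕ → ℤ × ℤ → ℤ × ℤ
step d (X , Y) = H d X Y - X , H d X Y

record Tracks (m t : ℕ) (s : ℤ × ℤ) : Set where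
  field
    stable     : ∀ k → t ≤ k → coeff k (+ m) ≡ proj₁ s
    vanishes   : coeff t (+ (m ℕ.+ fib (suc t))) ≡ + 0
    second     : coeff (suc t) (+ (m ℕ.+ fib (suc (suc t)))) ≡ proj₂ s
    bounded    : m < fib (suc t)
    top≤sum    : t ≤ m

a+b-b≡a : ∀ a b → (a + b) - b ≡ a
a+b-b≡a = solve-∀

coeff-suc-jump : ∀ i m → coeff (suc i) (+ (m ℕ.+ fib (suc i))) ≡ coeff i (+ (m ℕ.+ fib (suc i))) - coeff i (+ m)
coeff-suc-jump i m =
  trans (coeff-suc i _) (cong (λ k → coeff i (+ (m ℕ.+ fib (suc i))) - coeff i k) (a+b-b≡a (+ m) (+ fib (suc i))))

coeff-shift : ∀ i n → coeff (suc i) (+ (n ℕ.+ fib (suc (suc i)))) ≡ - coeff i (+ (n ℕ.+ fib i))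
coeff-shift i n = begin
    coeff (suc i) (+ (n ℕ.+ fib (2 ℕ.+ i)))
  ≡⟨ coeff-suc i _ ⟩
    coeff i (+ (n ℕ.+ fib (2 ℕ.+ i))) - coeff i (+ (n ℕ.+ fib (2 ℕ.+ i)) - + fib (suc i))
  ≡⟨ cong₂ _-_ (coeff-above i _ (ℕₚ.m≤n⇒m≤1+n (ℕₚ.m≤n+m _ n)))
               (cong (coeff i) (a+[b+c]-b≡a+c (+ n) (+ fib (suc i)) (+ fib i))) ⟩
    + 0 - coeff i (+ (n ℕ.+ fib i))
  ≡⟨ ℤₚ.+-identityˡ _ ⟩
    - coeff i (+ (n ℕ.+ fib i)) ∎
  where
  open ≡-Reasoning
  a+[b+c]-b≡a+c : ∀ a b c → (a + (b + c)) - b ≡ a + c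
  a+[b+c]-b≡a+c = solve-∀

coeff-suc-two-jumps : ∀ i m → coeff (suc i) (+ ((m ℕ.+ fib (suc i)) ℕ.+ fib (suc (suc i)))) ≡ + 0
coeff-suc-two-jumps i m = trans (coeff-shift i _) (cong -_ (coeff-above i _ (ℕₚ.m≤n⇒m≤1+n f≤m+fᵢ₊₁+fᵢ)))
  where
  f≤m+fᵢ₊₁+fᵢ : fib (suc (suc i)) ≤ (m ℕ.+ fib (suc i)) ℕ.+ fib i
  f≤m+fᵢ₊₁+fᵢ = ℕₚ.+-monoˡ-≤ (fib i) (ℕₚ.m≤n+m (fib (suc i)) m)

coeff-suc-suc-two-jumps : ∀ i m → coeff (suc (suc i)) (+ ((m ℕ.+ fib (suc i)) ℕ.+ fib (suc (suc (suc i)))))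
                                  ≡ coeff i (+ (m ℕ.+ fib (suc i)))
coeff-suc-suc-two-jumps i m = begin
    coeff (suc j) (+ (m′ ℕ.+ fib (suc (suc j))))
  ≡⟨ coeff-shift j m′ ⟩
    - coeff j (+ (m′ ℕ.+ fib j))
  ≡⟨ cong -_ (coeff-suc-jump i m′) ⟩
    - (coeff i (+ (m′ ℕ.+ fib j)) - coeff i (+ m′))
  ≡⟨ cong (λ a → - (a - coeff i (+ m′))) (coeff-above i _ f≤1+m′+fⱼ) ⟩
    - (+ 0 - coeff i (+ m′))
  ≡⟨ -[0-a]≡a (coeff i (+ m′)) ⟩
    coeff i (+ m′) ∎
  where
  open ≡-Reasoning
  j = suc i
  m′ = m ℕ.+ fib j
  f≤1+m′+fⱼ : fib (suc j) ≤ suc (m′ ℕ.+ fib j)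
  f≤1+m′+fⱼ = ℕₚ.m≤n⇒m≤1+n (ℕₚ.≤-trans (ℕₚ.+-monoʳ-≤ (fib j) (fib-≤-suc i))
                                       (ℕₚ.+-monoˡ-≤ (fib j) (ℕₚ.m≤n+m (fib j) m)))
  -[0-a]≡a : ∀ a → - (+ 0 - a) ≡ a
  -[0-a]≡a = solve-∀

module _ {m t s} (tr : Tracks m t s) where
  open Tracks tr
  private
    X = proj₁ s
    Y = proj₂ s

  coeff-jump : ∀ e → coeff (e ℕ.+ t) (+ (m ℕ.+ fib (suc (e ℕ.+ t)))) ≡ H (suc e) X Y
  coeff-jump zero = vanishes
  coeff-jump (suc zero) = trans second (Y≡-[X-Y]+X X Y)
    where Y≡-[X-Y]+X : ∀ X Y → Y ≡ - (X - Y) + X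
          Y≡-[X-Y]+X = solve-∀
  coeff-jump (suc (suc e)) = begin
      coeff (2 ℕ.+ i) (+ (m ℕ.+ fib (3 ℕ.+ i)))
    ≡⟨ coeff-shift (suc i) m ⟩
      - coeff (suc i) (+ (m ℕ.+ fib (suc i)))
    ≡⟨ cong -_ (coeff-suc-jump i m) ⟩
      - (coeff i (+ (m ℕ.+ fib (suc i))) - coeff i (+ m))
    ≡⟨ cong₂ (λ a b → - (a - b)) (coeff-jump e) (stable i (ℕₚ.m≤n+m t e)) ⟩
      - (H (suc e) X Y - X)
    ≡⟨ -[a-b]≡-a+b (H (suc e) X Y) X ⟩
      H (suc (suc (suc e))) X Y ∎
    where
    open ≡-Reasoning
    i = e ℕ.+ t
    -[a-b]≡-a+b : ∀ a b → - (a - b) ≡ - a + b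
    -[a-b]≡-a+b = solve-∀

  Tracks-step : ∀ e → m < fib (e ℕ.+ t) → Tracks (m ℕ.+ fib (suc (e ℕ.+ t))) (suc (e ℕ.+ t)) (step (suc e) s)
  Tracks-step e m<fᵢ = record
    { stable   = λ k j≤k → subst (λ k′ → coeff k′ (+ m′) ≡ Hₑ - X) (ℕₚ.m∸n+n≡m j≤k)
                             (trans (coeff-stable (k ∸ j) j bounded′) stable-j)
    ; vanishes = coeff-suc-two-jumps i m
    ; second   = trans (coeff-suc-suc-two-jumps i m) (coeff-jump e)
    ; bounded  = bounded′
    ; top≤sum  = ℕₚ.≤-trans (n≤fib j) (ℕₚ.m≤n+m (fib j) m)
    }
    where
    i = e ℕ.+ t
    j = suc i
    m′ = m ℕ.+ fib j
    Hₑ = H (suc e) X Y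
    bounded′ : m′ < fib (suc j)
    bounded′ = subst (suc m′ ≤_) (ℕₚ.+-comm (fib i) (fib j)) (ℕₚ.+-monoˡ-≤ (fib j) m<fᵢ)
    stable-j : coeff j (+ m′) ≡ Hₑ - X
    stable-j = trans (coeff-suc-jump i m) (cong₂ _-_ (coeff-jump e) (stable i (ℕₚ.m≤n+m t e)))

Tracks-start : Tracks 0 0 (+ 1 , + 0)
Tracks-start = record
  { stable = λ k _ → coeff-zero k ; vanishes = refl ; second = refl ; bounded = s≤s z≤n ; top≤sum = z≤n }

transfer : ℕ → ℤ × ℤ → List ℕ → ℤ × ℤ
transfer t s [] = s
transfer t s (i ∷ I) = transfer i (step (i ∸ t) s) I

gap-split : ∀ {t i} → 2 ℕ.+ t ≤ i → ∃ λ e → i ≡ suc (suc (e ℕ.+ t))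
gap-split {t} {i} 2+t≤i =
  i ∸ (2 ℕ.+ t) , trans (sym (ℕₚ.m∸n+n≡m 2+t≤i)) (trans (ℕₚ.+-suc _ (suc t)) (cong suc (ℕₚ.+-suc _ t)))

Tracks-transfer : ∀ I {m t s} → Tracks m t s → Gaps≥2 (t ∷ I) →
  ∃ λ t′ → Tracks (m ℕ.+ fibSum I) t′ (transfer t s I)
Tracks-transfer [] {m} {t} {s} tr _ = t , subst (λ k → Tracks k t s) (sym (ℕₚ.+-identityʳ m)) tr
Tracks-transfer (i ∷ I) {m} {t} {s} tr (g-cons 2+t≤i gaps) with gap-split 2+t≤i
... | e , refl rewrite ℕₚ.m+n∸n≡m (suc (suc e)) t
    with Tracks-transfer I (Tracks-step tr (suc e) m<f) gaps
  where m<f = ℕₚ.<-≤-trans (Tracks.bounded tr) (fib-mono-≤ (s≤s (ℕₚ.m≤n+m t e)))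
... | t′ , tr′ = t′ , subst (λ k → Tracks k t′ (transfer (suc (suc (e ℕ.+ t))) (step (suc (suc e)) s) I)) (ℕₚ.+-assoc m (fib (suc (suc (e ℕ.+ t)))) (fibSum I)) tr′

χ-transfer : ∀ n i I → IsZeckendorf n (i ∷ I) → χ n ≡ proj₁ (transfer 0 (+ 1 , + 0) (i ∷ I))
χ-transfer n zero I (record { positive = p-cons () _ } , _)
χ-transfer n (suc e) I (record { gaps = gaps } , refl) with Tracks-transfer I tr₁ gaps
  where
  tr₁ : Tracks (fib (suc e)) (suc e) (step (suc e) (+ 1 , + 0))
  tr₁ = subst (λ k → Tracks (fib (suc k)) (suc k) (step (suc e) (+ 1 , + 0))) (ℕₚ.+-identityʳ e)
          (Tracks-step Tracks-start e (0<fib (e ℕ.+ 0)))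
... | t′ , tr′ = begin
    χ n
  ≡⟨ χ≡signedCount n ⟩
    coeff n (+ n)
  ≡⟨ Tracks.stable tr′ n (Tracks.top≤sum tr′) ⟩
    proj₁ (transfer 0 (+ 1 , + 0) (suc e ∷ I)) ∎
  where open ≡-Reasoning

-- The transfer maps by parity of the gap

restart : Parity → ℤ → ℤ × ℤ
restart 0ℙ X = + 0 , X
restart 1ℙ X = - X , + 0

advance : Parity → ℤ × ℤ → ℤ × ℤ
advance 0ℙ (X , Y) = Y - X , Y
advance 1ℙ (X , Y) = - Y , X - Y

advances : List ℕ → ℤ × ℤ → ℤ × ℤ
advances [] s = s
advances (b ∷ T) s = advances T (advance (parityℙ b) s)

double : ℕ → ℕ
double zero = zero
double (suc h) = suc (suc (double h))

step-period : ∀ d s → step (4 ℕ.+ d) s ≡ step d s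
step-period d (X , Y) = cong (λ h → h - X , h) (-[-a+b]+b≡a (H d X Y) X)
  where -[-a+b]+b≡a : ∀ a b → - (- a + b) + b ≡ a
        -[-a+b]+b≡a = solve-∀

step-odd-gap : ∀ h s → step (suc (double h)) s ≡ restart (parityℙ (suc h)) (proj₁ s)
step-odd-gap zero (X , Y) = cong (_, + 0) (ℤₚ.+-identityˡ (- X))
step-odd-gap (suc zero) (X , Y) = cong₂ _,_ (-0+a-a≡0 X) (-0+a≡a X)
  where -0+a-a≡0 : ∀ a → - + 0 + a - a ≡ + 0
        -0+a-a≡0 = solve-∀
        -0+a≡a : ∀ a → - + 0 + a ≡ a
        -0+a≡a = solve-∀
step-odd-gap (suc (suc h)) s = trans (step-period (suc (double h)) s) (step-odd-gap h s)

step-even-gap : ∀ h s → step (suc (suc (double h))) s ≡ advance (parityℙ h) s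
step-even-gap zero (X , Y) = cong₂ _,_ (first X Y) (second X Y)
  where first : ∀ X Y → - (X - Y) + X - X ≡ Y - X
        first = solve-∀
        second : ∀ X Y → - (X - Y) + X ≡ Y
        second = solve-∀
step-even-gap (suc zero) (X , Y) = cong₂ _,_ (first X Y) (second X Y)
  where first : ∀ X Y → - (- (X - Y) + X) + X - X ≡ - Y
        first = solve-∀
        second : ∀ X Y → - (- (X - Y) + X) + X ≡ X - Y
        second = solve-∀
step-even-gap (suc (suc h)) s = trans (step-period (suc (suc (double h))) s) (step-even-gap h s)

-- Continuants and their parities

contStepℤ : ℕ → ℤ × ℤ → ℤ × ℤ
contStepℤ b (x , y) = + b * x - y , x

contℤ : List ℕ → ℤ × ℤ → ℤ × ℤ
contℤ [] v = v
contℤ (b ∷ T) v = contℤ T (contStepℤ b v)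

contℤ-∷ʳ : ∀ T b v → contℤ (T ∷ʳ b) v ≡ contStepℤ b (contℤ T v)
contℤ-∷ʳ [] b v = refl
contℤ-∷ʳ (c ∷ T) b v = contℤ-∷ʳ T b (contStepℤ c v)

contStepℤ-unit : ∀ b → contStepℤ b (+ 1 , + 0) ≡ (+ b , + 1)
contStepℤ-unit b = cong (_, + 1) (b*1-0≡b (+ b))
  where b*1-0≡b : ∀ b → b * + 1 - + 0 ≡ b
        b*1-0≡b = solve-∀

-- For R = (αᵣ, …, α₁) this is (D(α₁,…,αᵣ), D(α₁,…,αᵣ₋₁)), read as (1 , 0) when r = 0.
Dpair : List ℕ → ℤ × ℤ
Dpair [] = + 1 , + 0
Dpair (r ∷ R) = Drev (r ∷ R) (+ 1) , Drev R (+ 1)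

φ-at-1 : ∀ a → φ a (+ 1) ≡ + a
φ-at-1 zero = refl
φ-at-1 (suc a) = trans (cong₂ _+_ (φ-at-1 a) (ℤₚ.^-zeroˡ (suc a))) (cong +_ (ℕₚ.+-comm a 1))

contStepℤ-Dpair : ∀ r R → contStepℤ r (Dpair R) ≡ Dpair (r ∷ R)
contStepℤ-Dpair r [] = trans (contStepℤ-unit r) (cong (_, + 1) (sym (φ-at-1 r)))
contStepℤ-Dpair r (b ∷ R) = cong (_, Drev (b ∷ R) (+ 1)) (cong₂ (λ a c → a * Drev (b ∷ R) (+ 1) - c)
  (sym (φ-at-1 r)) (sym (trans (cong (_* Drev R (+ 1)) (ℤₚ.^-zeroˡ (suc r))) (ℤₚ.*-identityˡ _))))

contℤ-reverse : ∀ R → contℤ (reverse R) (+ 1 , + 0) ≡ Dpair R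
contℤ-reverse [] = refl
contℤ-reverse (r ∷ R) = begin
    contℤ (reverse (r ∷ R)) (+ 1 , + 0)
  ≡⟨ cong (λ L → contℤ L (+ 1 , + 0)) (Listₚ.unfold-reverse r R) ⟩
    contℤ (reverse R ∷ʳ r) (+ 1 , + 0)
  ≡⟨ contℤ-∷ʳ (reverse R) r (+ 1 , + 0) ⟩
    contStepℤ r (contℤ (reverse R) (+ 1 , + 0))
  ≡⟨ cong (contStepℤ r) (contℤ-reverse R) ⟩
    contStepℤ r (Dpair R)
  ≡⟨ contStepℤ-Dpair r R ⟩
    Dpair (r ∷ R) ∎
  where open ≡-Reasoning

D≡contℤ : ∀ B → D B ≡ proj₁ (contℤ B (+ 1 , + 0))
D≡contℤ B = begin
    Drev (reverse B) (+ 1)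
  ≡⟨ proj₁-Dpair (reverse B) ⟨
    proj₁ (Dpair (reverse B))
  ≡⟨ cong proj₁ (contℤ-reverse (reverse B)) ⟨
    proj₁ (contℤ (reverse (reverse B)) (+ 1 , + 0))
  ≡⟨ cong (λ L → proj₁ (contℤ L (+ 1 , + 0))) (Listₚ.reverse-involutive B) ⟩
    proj₁ (contℤ B (+ 1 , + 0)) ∎
  where
  open ≡-Reasoning
  proj₁-Dpair : ∀ R → proj₁ (Dpair R) ≡ Drev R (+ 1)
  proj₁-Dpair [] = refl
  proj₁-Dpair (_ ∷ _) = refl

contStep : ℕ → ℕ × ℕ → ℕ × ℕ
contStep b (X , Z) = b ℕ.* X ∸ Z , X

cont : List ℕ → ℕ × ℕ → ℕ × ℕ
cont [] v = v
cont (b ∷ T) v = cont T (contStep b v)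

Ordered : ℕ × ℕ → Set
Ordered (X , Z) = Z ≤ X

toℤ² : ℕ × ℕ → ℤ × ℤ
toℤ² (X , Z) = + X , + Z

module _ {b X Z} (2≤b : 2 ≤ b) (Z≤X : Z ≤ X) where

  X+Z≤b*X : X ℕ.+ Z ≤ b ℕ.* X
  X+Z≤b*X = ℕₚ.≤-trans (ℕₚ.+-monoʳ-≤ X Z≤X)
    (subst (_≤ b ℕ.* X) (cong (X ℕ.+_) (ℕₚ.+-identityʳ X)) (ℕₚ.*-monoˡ-≤ X 2≤b))

  Z≤b*X : Z ≤ b ℕ.* X
  Z≤b*X = ℕₚ.≤-trans (ℕₚ.m≤n+m Z X) X+Z≤b*X

  contStep-ordered : Ordered (contStep b (X , Z))
  contStep-ordered = ℕₚ.m+n≤o⇒m≤o∸n X X+Z≤b*X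

  contStepℤ-toℤ² : contStepℤ b (+ X , + Z) ≡ toℤ² (contStep b (X , Z))
  contStepℤ-toℤ² = cong (_, + X) (trans (cong (_- + Z) (sym (ℤₚ.pos-* b X))) (+-minus-+ Z≤b*X))

cont-ordered : ∀ T {v} → All (2 ≤_) T → Ordered v → Ordered (cont T v) × proj₁ v ≤ proj₁ (cont T v)
cont-ordered [] [] ord = ord , ℕₚ.≤-refl
cont-ordered (b ∷ T) (2≤b ∷ 2≤T) ord with cont-ordered T 2≤T (contStep-ordered 2≤b ord)
... | ord′ , X≤ = ord′ , ℕₚ.≤-trans (contStep-ordered 2≤b ord) X≤

contℤ-toℤ² : ∀ T {v} → All (2 ≤_) T → Ordered v → contℤ T (toℤ² v) ≡ toℤ² (cont T v)
contℤ-toℤ² [] [] _ = refl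
contℤ-toℤ² (b ∷ T) (2≤b ∷ 2≤T) ord =
  trans (cong (contℤ T) (contStepℤ-toℤ² 2≤b ord)) (contℤ-toℤ² T 2≤T (contStep-ordered 2≤b ord))

D≡cont : ∀ T → All (2 ≤_) T → D T ≡ + proj₁ (cont T (1 , 0))
D≡cont T 2≤T = trans (D≡contℤ T) (cong proj₁ (contℤ-toℤ² T 2≤T z≤n))

D-∷≡cont : ∀ β T → 0 < β → All (2 ≤_) T → D (β ∷ T) ≡ + proj₁ (cont T (β , 1))
D-∷≡cont β T 0<β 2≤T = begin
    D (β ∷ T)
  ≡⟨ D≡contℤ (β ∷ T) ⟩
    proj₁ (contℤ T (+ β * + 1 - + 0 , + 1))
  ≡⟨ cong (proj₁ ∘ contℤ T) (contStepℤ-unit β) ⟩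
    proj₁ (contℤ T (+ β , + 1))
  ≡⟨ cong proj₁ (contℤ-toℤ² T 2≤T 0<β) ⟩
    + proj₁ (cont T (β , 1)) ∎
  where open ≡-Reasoning

Unimodular : ℕ × ℕ → ℕ × ℕ → Set
Unimodular (X , Z) (X′ , Z′) = X′ ℕ.* Z ≡ suc (X ℕ.* Z′)

contStep-unimodular : ∀ {b X Z X′ Z′} → Z ≤ b ℕ.* X → Z′ ≤ b ℕ.* X′ →
  Unimodular (X , Z) (X′ , Z′) → Unimodular (contStep b (X , Z)) (contStep b (X′ , Z′))
contStep-unimodular {b} {X} {Z} {X′} {Z′} Z≤bX Z′≤bX′ uni = ℤₚ.+-injective (ℤₚ.i-j≡0⇒i≡j _ _ (begin
    + ((b ℕ.* X′ ∸ Z′) ℕ.* X) - + suc ((b ℕ.* X ∸ Z) ℕ.* X′)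
  ≡⟨ cong₂ (λ a c → a - (+ 1 + c)) (lift {b} {X′} Z′≤bX′ X) (lift {b} {X} Z≤bX X′) ⟩
    (+ b * + X′ - + Z′) * + X - (+ 1 + (+ b * + X - + Z) * + X′)
  ≡⟨ det-identity (+ b) (+ X) (+ Z) (+ X′) (+ Z′) ⟩
    + X′ * + Z - (+ 1 + + X * + Z′)
  ≡⟨ ℤₚ.i≡j⇒i-j≡0 (trans (sym (ℤₚ.pos-* X′ Z)) (trans (cong +_ uni) (cong (_+_ (+ 1)) (ℤₚ.pos-* X Z′)))) ⟩
    + 0 ∎))
  where
  open ≡-Reasoning
  lift : ∀ {b X Z} → Z ≤ b ℕ.* X → ∀ Y → + ((b ℕ.* X ∸ Z) ℕ.* Y) ≡ (+ b * + X - + Z) * + Y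
  lift {b} {X} {Z} Z≤bX Y = trans (ℤₚ.pos-* (b ℕ.* X ∸ Z) Y)
    (cong (_* + Y) (trans (sym (+-minus-+ Z≤bX)) (cong (_- + Z) (ℤₚ.pos-* b X))))
  det-identity : ∀ b X Z X′ Z′ → (b * X′ - Z′) * X - (+ 1 + (b * X - Z) * X′) ≡ X′ * Z - (+ 1 + X * Z′)
  det-identity = solve-∀

cont-unimodular : ∀ T {v v′} → All (2 ≤_) T → Ordered v → Ordered v′ → Unimodular v v′ →
  Unimodular (cont T v) (cont T v′)
cont-unimodular [] [] _ _ uni = uni
cont-unimodular (b ∷ T) (2≤b ∷ 2≤T) ord ord′ uni = cont-unimodular T 2≤T
  (contStep-ordered 2≤b ord) (contStep-ordered 2≤b ord′) (contStep-unimodular {b} (Z≤b*X 2≤b ord) (Z≤b*X 2≤b ord′) uni)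

parityℙ-∸ : ∀ {m n} → n ≤ m → parityℙ (m ∸ n) ≡ parityℙ m ℙ.+ parityℙ n
parityℙ-∸ {m} {n} n≤m = ℙₚ.+-cancelʳ-≡ (parityℙ n) _ _ (begin
    parityℙ (m ∸ n) ℙ.+ parityℙ n
  ≡⟨ ℙₚ.+-homo-+ (m ∸ n) n ⟨
    parityℙ (m ∸ n ℕ.+ n)
  ≡⟨ cong parityℙ (ℕₚ.m∸n+n≡m n≤m) ⟩
    parityℙ m
  ≡⟨ ℙₚ.+-identityʳ (parityℙ m) ⟨
    parityℙ m ℙ.+ 0ℙ
  ≡⟨ cong (parityℙ m ℙ.+_) (ℙₚ.p+p≡0ℙ (parityℙ n)) ⟨
    parityℙ m ℙ.+ (parityℙ n ℙ.+ parityℙ n)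
  ≡⟨ ℙₚ.+-assoc (parityℙ m) (parityℙ n) (parityℙ n) ⟨
    parityℙ m ℙ.+ parityℙ n ℙ.+ parityℙ n ∎)
  where open ≡-Reasoning

parityℙ-contStep : ∀ {b X Z} → Z ≤ b ℕ.* X → parityℙ (b ℕ.* X ∸ Z) ≡ parityℙ b ℙ.* parityℙ X ℙ.+ parityℙ Z
parityℙ-contStep {b} {X} Z≤bX = trans (parityℙ-∸ Z≤bX) (cong (ℙ._+ _) (ℙₚ.*-homo-* b X))

bit : Parity → ℤ
bit 0ℙ = + 0
bit 1ℙ = + 1

-- χ̃ of a reduced fraction whose denominator has parity p and numerator parity q.
χ̃ℙ : Parity → Parity → ℤ
χ̃ℙ p q = bit p * (+ 1 - + 2 * bit q)

-- The state within a block, determined by the parities (p , q) of the current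
-- continuant fraction and (p′ , q′) of the previous one.
blockState : Parity → Parity → Parity → Parity → ℤ × ℤ
blockState p q p′ q′ = χ̃ℙ p q , χ̃ℙ p q + χ̃ℙ p′ q′

advance-blockState : ∀ e p q p′ q′ → q ℙ.* p′ ≡ 1ℙ ℙ.+ (p ℙ.* q′) →
  advance e (blockState p q p′ q′) ≡ blockState (e ℙ.* p ℙ.+ p′) (e ℙ.* q ℙ.+ q′) p q
advance-blockState e 0ℙ 0ℙ _  _  ()
advance-blockState e 1ℙ 0ℙ _  0ℙ ()
advance-blockState e 0ℙ 1ℙ 0ℙ _  ()
advance-blockState e 1ℙ 1ℙ 0ℙ 0ℙ ()
advance-blockState e 1ℙ 1ℙ 1ℙ 1ℙ ()
advance-blockState 0ℙ 1ℙ 0ℙ 0ℙ 1ℙ _ = refl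
advance-blockState 0ℙ 1ℙ 0ℙ 1ℙ 1ℙ _ = refl
advance-blockState 0ℙ 0ℙ 1ℙ 1ℙ 0ℙ _ = refl
advance-blockState 0ℙ 0ℙ 1ℙ 1ℙ 1ℙ _ = refl
advance-blockState 0ℙ 1ℙ 1ℙ 0ℙ 1ℙ _ = refl
advance-blockState 0ℙ 1ℙ 1ℙ 1ℙ 0ℙ _ = refl
advance-blockState 1ℙ 1ℙ 0ℙ 0ℙ 1ℙ _ = refl
advance-blockState 1ℙ 1ℙ 0ℙ 1ℙ 1ℙ _ = refl
advance-blockState 1ℙ 0ℙ 1ℙ 1ℙ 0ℙ _ = refl
advance-blockState 1ℙ 0ℙ 1ℙ 1ℙ 1ℙ _ = refl
advance-blockState 1ℙ 1ℙ 1ℙ 0ℙ 1ℙ _ = refl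
advance-blockState 1ℙ 1ℙ 1ℙ 1ℙ 0ℙ _ = refl

blockStateOf : ℕ × ℕ → ℕ × ℕ → ℤ × ℤ
blockStateOf (X , Z) (X′ , Z′) = blockState (parityℙ X) (parityℙ X′) (parityℙ Z) (parityℙ Z′)

advances-blockStateOf : ∀ T {v v′} → All (2 ≤_) T → Ordered v → Ordered v′ → Unimodular v v′ →
  advances T (blockStateOf v v′) ≡ blockStateOf (cont T v) (cont T v′)
advances-blockStateOf [] [] _ _ _ = refl
advances-blockStateOf (b ∷ T) {X , Z} {X′ , Z′} (2≤b ∷ 2≤T) ord ord′ uni = begin
    advances T (advance (parityℙ b) (blockStateOf (X , Z) (X′ , Z′)))
  ≡⟨ cong (advances T) (advance-blockState (parityℙ b) (parityℙ X) (parityℙ X′) (parityℙ Z) (parityℙ Z′) uniℙ) ⟩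
    advances T (blockState (parityℙ b ℙ.* parityℙ X ℙ.+ parityℙ Z) (parityℙ b ℙ.* parityℙ X′ ℙ.+ parityℙ Z′)
                           (parityℙ X) (parityℙ X′))
  ≡⟨ cong₂ (λ p q → advances T (blockState p q (parityℙ X) (parityℙ X′)))
           (parityℙ-contStep {b} (Z≤b*X 2≤b ord)) (parityℙ-contStep {b} (Z≤b*X 2≤b ord′)) ⟨
    advances T (blockStateOf (contStep b (X , Z)) (contStep b (X′ , Z′)))
  ≡⟨ advances-blockStateOf T 2≤T (contStep-ordered 2≤b ord) (contStep-ordered 2≤b ord′)
       (contStep-unimodular {b} (Z≤b*X 2≤b ord) (Z≤b*X 2≤b ord′) uni) ⟩
    blockStateOf (cont T (contStep b (X , Z))) (cont T (contStep b (X′ , Z′))) ∎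
  where
  open ≡-Reasoning
  uniℙ : parityℙ X′ ℙ.* parityℙ Z ≡ 1ℙ ℙ.+ (parityℙ X ℙ.* parityℙ Z′)
  uniℙ = begin
      parityℙ X′ ℙ.* parityℙ Z  ≡⟨ ℙₚ.*-homo-* X′ Z ⟨
      parityℙ (X′ ℕ.* Z)         ≡⟨ cong parityℙ uni ⟩
      parityℙ (1 ℕ.+ X ℕ.* Z′)   ≡⟨ ℙₚ.+-homo-+ 1 (X ℕ.* Z′) ⟩
      1ℙ ℙ.+ parityℙ (X ℕ.* Z′)  ≡⟨ cong (1ℙ ℙ.+_) (ℙₚ.*-homo-* X Z′) ⟩
      1ℙ ℙ.+ (parityℙ X ℙ.* parityℙ Z′) ∎

unimodular⇒coprime : ∀ {X Z X′ Z′} → Unimodular (X , Z) (X′ , Z′) → Coprime X′ X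
unimodular⇒coprime {X} {Z} {X′} {Z′} uni {d} (d∣X′ , d∣X) = ∣1⇒≡1 (∣m+n∣m⇒∣n d∣XZ′+1 (∣m⇒∣m*n Z′ d∣X))
  where
  d∣XZ′+1 : d ∣ X ℕ.* Z′ ℕ.+ 1
  d∣XZ′+1 = subst (d ∣_) (trans uni (ℕₚ.+-comm 1 (X ℕ.* Z′))) (∣m⇒∣m*n Z d∣X′)

lam-parity : ∀ n → lam (+ n) ≡ bit (parityℙ n)
lam-parity zero = refl
lam-parity (suc zero) = refl
lam-parity (suc (suc n)) = lam-parity n

χ̃-frac : ∀ {A} B → 0 < A → Coprime B A → χ̃ (frac (+ B) (+ A)) ≡ χ̃ℙ (parityℙ A) (parityℙ B)
χ̃-frac {suc k} B _ cop rewrite ℚₚ.normalize-coprime {B} {k} cop =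
  cong₂ (λ a b → a * (+ 1 - + 2 * b)) (lam-parity (suc k)) (lam-parity B)

*-distribˡ-minus : ∀ X a b → X * a - X * b ≡ X * (a - b)
*-distribˡ-minus = solve-∀

scale : ℤ → ℤ × ℤ → ℤ × ℤ
scale X (a , b) = X * a , X * b

advance-scale : ∀ p X s → advance p (scale X s) ≡ scale X (advance p s)
advance-scale 0ℙ X (a , b) = cong (_, X * b) (*-distribˡ-minus X b a)
advance-scale 1ℙ X (a , b) = cong₂ _,_ (ℤₚ.neg-distribʳ-* X b) (*-distribˡ-minus X a b)

advances-scale : ∀ T X s → advances T (scale X s) ≡ scale X (advances T s)
advances-scale [] X s = refl
advances-scale (b ∷ T) X s =
  trans (cong (advances T) (advance-scale (parityℙ b) X s)) (advances-scale T X (advance (parityℙ b) s))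

restart-scale : ∀ p X → restart p X ≡ scale X (restart p (+ 1))
restart-scale 0ℙ X = sym (cong₂ _,_ (ℤₚ.*-zeroʳ X) (ℤₚ.*-identityʳ X))
restart-scale 1ℙ X = cong₂ _,_ (sym (trans (ℤₚ.*-comm X (- + 1)) (ℤₚ.-1*i≡-i X))) (sym (ℤₚ.*-zeroʳ X))

restart-blockStateOf : ∀ β → restart (parityℙ β) (+ 1) ≡ blockStateOf (β , 1) (1 , 0)
restart-blockStateOf β with parityℙ β
... | 0ℙ = refl
... | 1ℙ = refl

block-value : ∀ β T X → 0 < β → All (2 ≤_) T →
  proj₁ (advances T (restart (parityℙ β) X)) ≡ X * χ̃ (bracket (β ∷ T))
block-value β T X 0<β 2≤T = begin
    proj₁ (advances T (restart (parityℙ β) X))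
  ≡⟨ cong (proj₁ ∘ advances T) (restart-scale (parityℙ β) X) ⟩
    proj₁ (advances T (scale X (restart (parityℙ β) (+ 1))))
  ≡⟨ cong proj₁ (advances-scale T X (restart (parityℙ β) (+ 1))) ⟩
    X * proj₁ (advances T (restart (parityℙ β) (+ 1)))
  ≡⟨ cong (λ s → X * proj₁ (advances T s)) (restart-blockStateOf β) ⟩
    X * proj₁ (advances T (blockStateOf (β , 1) (1 , 0)))
  ≡⟨ cong (λ s → X * proj₁ s) (advances-blockStateOf T 2≤T 0<β z≤n (cong suc (sym (ℕₚ.*-zeroʳ β)))) ⟩
    X * χ̃ℙ (parityℙ A) (parityℙ B)
  ≡⟨ cong (X *_) (χ̃-frac B (ℕₚ.<-≤-trans 0<β β≤A) (unimodular⇒coprime uni)) ⟨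
    X * χ̃ (frac (+ B) (+ A))
  ≡⟨ cong₂ (λ b a → X * χ̃ (frac b a)) (D≡cont T 2≤T) (D-∷≡cont β T 0<β 2≤T) ⟨
    X * χ̃ (bracket (β ∷ T)) ∎
  where
  open ≡-Reasoning
  A = proj₁ (cont T (β , 1))
  B = proj₁ (cont T (1 , 0))
  β≤A : β ≤ A
  β≤A = proj₂ (cont-ordered T 2≤T 0<β)
  uni : Unimodular (cont T (β , 1)) (cont T (1 , 0))
  uni = cont-unimodular T 2≤T 0<β z≤n (cong suc (sym (ℕₚ.*-zeroʳ β)))

-- Parity runs of the Zeckendorf representation

blockSign : List ℕ → ℤ
blockSign B = χ̃ (bracket B)

runs-head : ∀ y ys → ∃₂ λ R Rs → runs (y ∷ ys) ≡ (y ∷ R) ∷ Rs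
runs-head y [] = [] , [] , refl
runs-head y (z ∷ zs) with runs-head z zs
... | R , Rs , eq rewrite eq with parity y ℕ.≡ᵇ parity z
... | true = z ∷ R , Rs , refl
... | false = [] , (z ∷ R) ∷ Rs , refl

runs-same : ∀ x y ys R Rs → runs (y ∷ ys) ≡ (y ∷ R) ∷ Rs → (parity x ℕ.≡ᵇ parity y) ≡ true →
  runs (x ∷ y ∷ ys) ≡ (x ∷ y ∷ R) ∷ Rs
runs-same x y ys R Rs eq same rewrite eq | same = refl

runs-diff : ∀ x y ys R Rs → runs (y ∷ ys) ≡ (y ∷ R) ∷ Rs → (parity x ℕ.≡ᵇ parity y) ≡ false →
  runs (x ∷ y ∷ ys) ≡ [ x ] ∷ (y ∷ R) ∷ Rs
runs-diff x y ys R Rs eq diff rewrite eq | diff = refl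

%2-double-+ : ∀ h x → (double h ℕ.+ x) % 2 ≡ x % 2
%2-double-+ zero x = refl
%2-double-+ (suc h) x = %2-double-+ h x

%2-suc-double-+ : ∀ h x → suc (double h ℕ.+ x) % 2 ≡ suc x % 2
%2-suc-double-+ zero x = refl
%2-suc-double-+ (suc h) x = %2-suc-double-+ h x

%2-≡ᵇ-refl : ∀ x → (x % 2 ℕ.≡ᵇ x % 2) ≡ true
%2-≡ᵇ-refl zero = refl
%2-≡ᵇ-refl (suc zero) = refl
%2-≡ᵇ-refl (suc (suc x)) = %2-≡ᵇ-refl x

%2-≡ᵇ-suc : ∀ x → (x % 2 ℕ.≡ᵇ suc x % 2) ≡ false
%2-≡ᵇ-suc zero = refl
%2-≡ᵇ-suc (suc zero) = refl
%2-≡ᵇ-suc (suc (suc x)) = %2-≡ᵇ-suc x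

parity-even-gap : ∀ h x → (parity x ℕ.≡ᵇ parity (suc (suc (double h ℕ.+ x)))) ≡ true
parity-even-gap h x = trans (cong (x % 2 ℕ.≡ᵇ_) (%2-double-+ h x)) (%2-≡ᵇ-refl x)

parity-odd-gap : ∀ h x → (parity x ℕ.≡ᵇ parity (suc (suc (suc (double h ℕ.+ x))))) ≡ false
parity-odd-gap h x = trans (cong (x % 2 ℕ.≡ᵇ_) (%2-suc-double-+ h x)) (%2-≡ᵇ-suc x)

/2-suc-suc : ∀ x → suc (suc x) / 2 ≡ suc (x / 2)
/2-suc-suc x = DivMod.m/n≡1+[m∸n]/n {suc (suc x)} {2} (s≤s (s≤s z≤n))

double-/2 : ∀ h → double h / 2 ≡ h
double-/2 zero = refl
double-/2 (suc h) = trans (/2-suc-suc (double h)) (cong suc (double-/2 h))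

suc-double-/2 : ∀ h → suc (double h) / 2 ≡ h
suc-double-/2 zero = refl
suc-double-/2 (suc h) = trans (/2-suc-suc (suc (double h))) (cong suc (suc-double-/2 h))

double-or-suc-double : ∀ e → (∃ λ h → e ≡ double h) ⊎ (∃ λ h → e ≡ suc (double h))
double-or-suc-double zero = inj₁ (0 , refl)
double-or-suc-double (suc e) with double-or-suc-double e
... | inj₁ (h , refl) = inj₂ (h , refl)
... | inj₂ (h , refl) = inj₁ (suc h , refl)

gap-parity : ∀ {x y} → 2 ℕ.+ x ≤ y →
  (∃ λ h → y ≡ suc (suc (double h ℕ.+ x))) ⊎ (∃ λ h → y ≡ suc (suc (suc (double h ℕ.+ x))))
gap-parity 2+x≤y with gap-split 2+x≤y
... | e , refl with double-or-suc-double e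
... | inj₁ (h , refl) = inj₁ (h , refl)
... | inj₂ (h , refl) = inj₂ (h , refl)

transfer-runs : ∀ ys x s R Rs → runs (x ∷ ys) ≡ (x ∷ R) ∷ Rs → Gaps≥2 (x ∷ ys) →
  let T = take (length R) (assocFrom x ys)
      P = productℤ (map blockSign (splitBy (map length Rs) (drop (length R) (assocFrom x ys))))
  in All (2 ≤_) T × proj₁ (transfer x s ys) ≡ proj₁ (advances T s) * P
transfer-runs [] x s R Rs refl _ = [] , sym (ℤₚ.*-identityʳ (proj₁ s))
transfer-runs (y ∷ ys) x s R Rs eq (g-cons 2+x≤y gaps) with runs-head y ys | gap-parity 2+x≤y
... | R′ , Rs′ , eq′ | inj₁ (h , refl)
    with trans (sym eq) (runs-same x _ ys R′ Rs′ eq′ (parity-even-gap h x))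
... | refl
    rewrite ℕₚ.m+n∸n≡m (suc (suc (double h))) x | double-/2 (suc h) | step-even-gap h s
    with transfer-runs ys _ (advance (parityℙ h) s) R′ Rs′ eq′ gaps
... | 2≤T , ih = s≤s (s≤s z≤n) ∷ 2≤T , ih
transfer-runs (y ∷ ys) x s R Rs eq (g-cons 2+x≤y gaps) | R′ , Rs′ , eq′ | inj₂ (h , refl)
    with trans (sym eq) (runs-diff x _ ys R′ Rs′ eq′ (parity-odd-gap h x))
... | refl
    rewrite ℕₚ.m+n∸n≡m (suc (suc (suc (double h)))) x | suc-double-/2 (suc h) | step-odd-gap (suc h) s
    with transfer-runs ys _ (restart (parityℙ (suc (suc h))) (proj₁ s)) R′ Rs′ eq′ gaps
... | 2≤T , ih = [] , (begin
    proj₁ (transfer y′ (restart (parityℙ α) (proj₁ s)) ys)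
  ≡⟨ ih ⟩
    proj₁ (advances T (restart (parityℙ α) (proj₁ s))) * P
  ≡⟨ cong (_* P) (block-value α T (proj₁ s) (s≤s z≤n) 2≤T) ⟩
    proj₁ s * blockSign (α ∷ T) * P
  ≡⟨ ℤₚ.*-assoc (proj₁ s) (blockSign (α ∷ T)) P ⟩
    proj₁ s * (blockSign (α ∷ T) * P) ∎)
  where
  open ≡-Reasoning
  α = suc (suc h)
  y′ = suc (suc (suc (double h ℕ.+ x)))
  T = take (length R′) (assocFrom y′ ys)
  P = productℤ (map blockSign (splitBy (map length Rs′) (drop (length R′) (assocFrom y′ ys))))

advance-unit : ∀ h → advance (parityℙ h) (+ 1 , + 0) ≡ restart (parityℙ (suc h)) (+ 1)
advance-unit zero = refl
advance-unit (suc zero) = refl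
advance-unit (suc (suc h)) = advance-unit h

-- transfer measures the first gap from index 0, whereas α₁ = ⌊(i₁ - 1)/2⌋ + 1 is measured from 1.
first-step : ∀ x → step (suc x) (+ 1 , + 0) ≡ restart (parityℙ (suc (x / 2))) (+ 1)
first-step x with double-or-suc-double x
... | inj₁ (h , refl) rewrite double-/2 h = step-odd-gap h (+ 1 , + 0)
... | inj₂ (h , refl) rewrite suc-double-/2 h = trans (step-even-gap h (+ 1 , + 0)) (advance-unit h)

theorem2p3 : (n : ℕ) → 0 < n → (I : List ℕ) → IsZeckendorf n I →
    χ n ≡ productℤ (map (λ B → χ̃ (bracket B)) (multivector I))
theorem2p3 _ () [] (_ , refl)
theorem2p3 n _ (zero ∷ I) (record { positive = p-cons () _ } , _)
theorem2p3 n _ (suc x ∷ I) zeck@(record { gaps = gaps } , _) with runs-head (suc x) I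
... | R , Rs , eq with transfer-runs I (suc x) (restart (parityℙ α) (+ 1)) R Rs eq gaps
  where α = suc (x / 2)
... | 2≤T , runs-eq = begin
    χ n
  ≡⟨ χ-transfer n (suc x) I zeck ⟩
    proj₁ (transfer (suc x) (step (suc x) (+ 1 , + 0)) I)
  ≡⟨ cong (λ s → proj₁ (transfer (suc x) s I)) (first-step x) ⟩
    proj₁ (transfer (suc x) (restart (parityℙ α) (+ 1)) I)
  ≡⟨ runs-eq ⟩
    proj₁ (advances T (restart (parityℙ α) (+ 1))) * P
  ≡⟨ cong (_* P) (trans (block-value α T (+ 1) (s≤s z≤n) 2≤T) (ℤₚ.*-identityˡ _)) ⟩
    blockSign (α ∷ T) * P
  ≡⟨ cong (λ rs → productℤ (map blockSign (splitBy (map length rs) (assocVec (suc x ∷ I))))) eq ⟨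
    productℤ (map blockSign (multivector (suc x ∷ I))) ∎
  where
  open ≡-Reasoning
  α = suc (x / 2)
  T = take (length R) (assocFrom (suc x) I)
  P = productℤ (map blockSign (splitBy (map length Rs) (drop (length R) (assocFrom (suc x) I))))
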